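{- Let $n\ge1$ and $w,u\in S_n$. Assume that $\beta=(\beta_1,\dots,\beta_p):=\operatorname{cLRM}'(w)$ and $\gamma=(\gamma_1,\dots,\gamma_p):=\operatorname{cLRM}'(u)$ are anagrams of one another, and let $\chi\in S_p$ satisfy $\beta_{\chi(i)}=\gamma_i$ for each $i\in[p]$. Let $v\in S_n$ be a permutation that, for each $i\in[p]$, sends $\operatorname{Set}(\gamma)_i$ to $\operatorname{Set}(\beta)_{\chi(i)}$ and has V-shape on $\operatorname{Set}(\gamma)_i$. Assume $vu=w$. Then $\chi=\operatorname{id}$, $v=\operatorname{id}$ and $\gamma=\beta$.
   Context: $S_n$ is the symmetric group on $[n]$ with product $(vu)(i)=v(u(i))$. For a composition $\alpha=(\alpha_1,\dots,\alpha_p)$ of $n$ (positive integers summing to $n$), $\alpha_{\le i}=\alpha_1+\cdots+\alpha_i$ and $\operatorname{Set}(\alpha)_i=\{\alpha_{\le i-1}+1,\dots,\alpha_{\le i}\}$. For $I=\{i_1<\dots<i_{p-1}\}\subseteq[n-1]$, $\operatorname{Comp}(I)=(i_1-i_0,\dots,i_p-i_{p-1})$ with $i_0=0,i_p=n$. $\operatorname{LRM}(w)=\{i\in[n]\mid w(k)>i\text{ for all }k<w^{ -1}(i)\}$, $\operatorname{LRM}'(w)=\{\ell-1\mid\ell\in\operatorname{LRM}(w),\ \ell>1\}$, $\operatorname{cLRM}'(w)=\operatorname{Comp}(\operatorname{LRM}'(w))$. Two compositions are anagrams if they have the same multiset of parts. A permutation $v$ has V-shape on an interval $\{i,\dots,j\}$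 if $v(i)>v(i+1)>\cdots>v(m)<v(m+1)<\cdots<v(j)$ for some $m\in\{i,\dots,j\}$. -}

module Defs where

open import Data.Nat using (ℕ; zero; suc; _≤_; _<_; _∸_; _≟_)
open import Data.Fin using (Fin; toℕ) renaming (_<_ to _<ᶠ_)
open import Data.Fin.Properties using (all?) renaming (_<?_ to _<ᶠ?_)
import Data.Nat.Properties as ℕP
open import Data.Fin.Permutation using (Permutation′; _⟨$⟩ʳ_; _⟨$⟩ˡ_)
open import Data.List using (List; []; _∷_; filter; map; take; allFin)
open import Data.Nat.ListAction using (sum)
open import Data.List.Properties using ()
open import Data.Product using (Σ; _×_; ∃)
open import Relation.Nullary using (Dec; ¬_)
open import Relation.Nullary.Decidable using (_→-dec_; _×-dec_; ¬?)
open import Relation.Binary.PropositionalEquality using (_≡_)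

-- Convention: [n] = {1,…,n} is modelled by Fin n = {0,…,n-1}, shifted by one.
-- A permutation of [n] is a stdlib Permutation′ n; w(i) is  w ⟨$⟩ʳ i.

IsLRM : ∀ {n} → Permutation′ n → Fin n → Set
IsLRM w j = ∀ k → toℕ k < toℕ (w ⟨$⟩ˡ j) → j <ᶠ (w ⟨$⟩ʳ k)

isLRM? : ∀ {n} (w : Permutation′ n) (j : Fin n) → Dec (IsLRM w j)
isLRM? w j = all? (λ k → (toℕ k ℕP.<? toℕ (w ⟨$⟩ˡ j)) →-dec (j <ᶠ? (w ⟨$⟩ʳ k)))

-- LRM'(w) = {ℓ-1 | ℓ ∈ LRM(w), ℓ > 1} ⊆ [n-1]  (1-based ℓ = toℕ j + 1),
-- listed in increasing order.
LRM′ : ∀ {n} → Permutation′ n → List ℕ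
LRM′ {n} w =
  map toℕ (filter (λ j → isLRM? w j ×-dec ¬? (toℕ j ≟ 0)) (allFin n))

compAux : ℕ → List ℕ → ℕ → List ℕ
compAux prev []       n = (n ∸ prev) ∷ []
compAux prev (i ∷ is) n = (i ∸ prev) ∷ compAux i is n

Comp : ℕ → List ℕ → List ℕ
Comp n I = compAux 0 I n

cLRM′ : ∀ {n} → Permutation′ n → List ℕ
cLRM′ {n} w = Comp n (LRM′ w)

-- Set(α)_i, for the 0-based part index i, as a set of 0-based positions:
-- α_{≤ i-1} ≤ x < α_{≤ i}  (1-based: {α_{≤i-1}+1, …, α_{≤i}}).
InSet : ∀ {n} → List ℕ → ℕ → Fin n → Set
InSet α i x = sum (take i α) ≤ toℕ x × toℕ x < sum (take (suc i) α)

VShape : ∀ {n} → Permutation′ n → ℕ → ℕ → Set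
VShape {n} v a b = Σ (Fin n) λ m → a ≤ toℕ m × toℕ m < b
  × (∀ (x y : Fin n) → toℕ y ≡ suc (toℕ x) → a ≤ toℕ x → toℕ y ≤ toℕ m
       → (v ⟨$⟩ʳ y) <ᶠ (v ⟨$⟩ʳ x))
  × (∀ (x y : Fin n) → toℕ y ≡ suc (toℕ x) → toℕ m ≤ toℕ x → toℕ y < b
       → (v ⟨$⟩ʳ x) <ᶠ (v ⟨$⟩ʳ y))

VShapeOnSet : ∀ {n} → Permutation′ n → List ℕ → ℕ → Set
VShapeOnSet v α i = VShape v (sum (take i α)) (sum (take (suc i) α))

{-# OPTIONS --safe #-}
module Submission where

-- Scan u from left to right, keeping the running minimum μ of the values seen so far
-- (μ = n before the scan starts), with the invariant that v fixes every value ≥ μ.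
-- When u(s) = y drops below μ, y is a left-to-right minimum of u, so [y, μ) is a part
-- of cLRM′(u); as v fixes the values ≥ μ, w = v ∘ u has the same prefix minimum μ and
-- [v(y), μ) is a part of cLRM′(w). The hypotheses force χ to match these two parts;
-- equal lengths give v(y) = y, and a V-shaped map of [y, μ) into itself fixing its
-- lowest point is the identity. At the end of the scan μ = 0, so v = id, hence w = u,
-- and χ = id because the parts are nonempty.

open import Defs
open import Data.Nat using (ℕ; zero; suc; _+_; _∸_; _≤_; _<_; z≤n; s≤s)
open import Data.Nat.Properties
open import Data.Fin using (Fin; zero; suc; toℕ; cast; fromℕ<) renaming (_<_ to _<ᶠ_)
open import Data.Fin.Properties using (toℕ-injective; toℕ-fromℕ<; toℕ-cast; toℕ<n; cast-involutive)
open import Data.Fin.Permutation using (Permutation′; _⟨$⟩ʳ_; _⟨$⟩ˡ_; _≈_; id; inverseˡ; inverseʳ)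
open import Data.List using (List; []; _∷_; length; lookup; take; map; allFin)
open import Data.List.Properties using (filter-≐)
open import Data.Nat.ListAction using (sum)
open import Data.List.Membership.Propositional using (_∈_)
open import Data.List.Membership.Propositional.Properties using (∈-map⁺; ∈-map⁻; ∈-filter⁺; ∈-filter⁻; ∈-allFin)
open import Data.List.Relation.Unary.Any using (here; there)
open import Data.List.Relation.Unary.All as All using (All; []; _∷_)
open import Data.List.Relation.Unary.AllPairs using (AllPairs; _∷_)
import Data.List.Relation.Unary.AllPairs.Properties as AllPairs
open import Data.List.Relation.Binary.Permutation.Propositional using (_↭_)
open import Data.Sum using (_⊎_; inj₁; inj₂)
open import Data.Product using (Σ; ∃-syntax; _×_; _,_; proj₁; proj₂)
open import Data.Empty using (⊥; ⊥-elim)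
open import Function.Bundles using (Injection)
open import Function.Properties.Inverse using (↔⇒↣)
open import Relation.Nullary using (¬_; Dec; yes; no)
open import Relation.Nullary.Decidable using (_×-dec_; ¬?)
open import Relation.Binary.PropositionalEquality
open import Relation.Binary.Definitions using (tri<; tri≈; tri>)

prefixSum : List ℕ → ℕ → ℕ
prefixSum α i = sum (take i α)

prefixSum-mono : ∀ α {i j} → i ≤ j → prefixSum α i ≤ prefixSum α j
prefixSum-mono []      {zero}  _         = z≤n
prefixSum-mono []      {suc _} _         = z≤n
prefixSum-mono (_ ∷ _) {zero}  _         = z≤n
prefixSum-mono (x ∷ α) {suc _} (s≤s i≤j) = +-monoʳ-≤ x (prefixSum-mono α i≤j)

prefixSum-suc : ∀ α (k : Fin (length α)) →
  prefixSum α (suc (toℕ k)) ≡ prefixSum α (toℕ k) + lookup α k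
prefixSum-suc (x ∷ α) zero    = +-identityʳ x
prefixSum-suc (x ∷ α) (suc k) = trans (cong (x +_) (prefixSum-suc α k)) (sym (+-assoc x _ _))

InSet-unique : ∀ {n} α {a c} {x : Fin n} → InSet α a x → InSet α c x → a ≡ c
InSet-unique α {a} {c} (a≤x , x<a+1) (c≤x , x<c+1) with <-cmp a c
... | tri< a<c _ _ = ⊥-elim (<⇒≱ x<a+1 (≤-trans (prefixSum-mono α a<c) c≤x))
... | tri≈ _ a≡c _ = a≡c
... | tri> _ _ c<a = ⊥-elim (<⇒≱ x<c+1 (≤-trans (prefixSum-mono α c<a) a≤x))

record Part (α : List ℕ) (a b : ℕ) : Set where
  constructor part
  field
    index : Fin (length α)
    start : prefixSum α (toℕ index) ≡ a
    end   : prefixSum α (suc (toℕ index)) ≡ b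

module _ {α a b} (P : Part α a b) where
  open Part P

  Part-length : b ≡ a + lookup α index
  Part-length = begin
    b                                 ≡⟨ end ⟨
    prefixSum α (suc (toℕ index))     ≡⟨ prefixSum-suc α index ⟩
    prefixSum α (toℕ index) + lookup α index ≡⟨ cong (_+ lookup α index) start ⟩
    a + lookup α index                ∎
    where open ≡-Reasoning

  InSet-Part⁺ : ∀ {n} {x : Fin n} → a ≤ toℕ x → toℕ x < b → InSet α (toℕ index) x
  InSet-Part⁺ a≤x x<b = subst (_≤ _) (sym start) a≤x , subst (_ <_) (sym end) x<b

  InSet-Part⁻ : ∀ {n} {x : Fin n} → InSet α (toℕ index) x → a ≤ toℕ x × toℕ x < b
  InSet-Part⁻ (a≤x , x<b) = subst (_≤ _) start a≤x , subst (_ <_) end x<b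

head-≤ : ∀ {l a L} → AllPairs _<_ (l ∷ L) → a ∈ l ∷ L → l ≤ a
head-≤ _             (here refl) = ≤-refl
head-≤ (l<L ∷ _) (there a∈L) = <⇒≤ (All.lookup l<L a∈L)

compAux-first : ∀ {prev c} rest → prev ≤ c →
  prev + prefixSum ((c ∸ prev) ∷ rest) 1 ≡ c
compAux-first {prev} {c} _ prev≤c =
  trans (cong (prev +_) (+-identityʳ (c ∸ prev))) (m+[n∸m]≡n prev≤c)

compAux-suc : ∀ {prev l} L n i → prev ≤ l →
  prev + prefixSum (compAux prev (l ∷ L) n) (suc i) ≡ l + prefixSum (compAux l L n) i
compAux-suc {prev} {l} L n i prev≤l = begin
  prev + ((l ∸ prev) + s)  ≡⟨ +-assoc prev (l ∸ prev) s ⟨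
  prev + (l ∸ prev) + s    ≡⟨ cong (_+ s) (m+[n∸m]≡n prev≤l) ⟩
  l + s                    ∎
  where
  open ≡-Reasoning
  s : ℕ
  s = prefixSum (compAux l L n) i

compAux-first-bounds : ∀ {prev c n} rest → prev < c → c ≤ n →
  prev + prefixSum ((c ∸ prev) ∷ rest) 0 < prev + prefixSum ((c ∸ prev) ∷ rest) 1
  × prev + prefixSum ((c ∸ prev) ∷ rest) 1 ≤ n
compAux-first-bounds {prev} {c} {n} rest prev<c c≤n =
  subst₂ _<_ (sym (+-identityʳ prev)) (sym first) prev<c , subst (_≤ n) (sym first) c≤n
  where
  first : prev + prefixSum ((c ∸ prev) ∷ rest) 1 ≡ c
  first = compAux-first rest (<⇒≤ prev<c)

compAux-part-bounds : ∀ {prev} L n → AllPairs _<_ (prev ∷ L) → All (_< n) (prev ∷ L) →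
  (i : Fin (length (compAux prev L n))) →
  prev + prefixSum (compAux prev L n) (toℕ i) < prev + prefixSum (compAux prev L n) (suc (toℕ i))
  × prev + prefixSum (compAux prev L n) (suc (toℕ i)) ≤ n
compAux-part-bounds []      n _                   (prev<n ∷ [])    zero =
  compAux-first-bounds [] prev<n ≤-refl
compAux-part-bounds (l ∷ L) n ((prev<l ∷ _) ∷ _) (_ ∷ l<n ∷ _) zero =
  compAux-first-bounds (compAux l L n) prev<l (<⇒≤ l<n)
compAux-part-bounds {prev} (l ∷ L) n ((prev<l ∷ _) ∷ sorted) (_ ∷ bounded) (suc i)
  with compAux-part-bounds L n sorted bounded i
... | nonempty , ≤n =
  subst₂ _<_ (sym shift₀) (sym shift₁) nonempty , subst (_≤ n) (sym shift₁) ≤n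
  where
  shift₀ : prev + prefixSum (compAux prev (l ∷ L) n) (suc (toℕ i)) ≡ l + prefixSum (compAux l L n) (toℕ i)
  shift₀ = compAux-suc L n (toℕ i) (<⇒≤ prev<l)
  shift₁ : prev + prefixSum (compAux prev (l ∷ L) n) (2 + toℕ i) ≡ l + prefixSum (compAux l L n) (suc (toℕ i))
  shift₁ = compAux-suc L n (suc (toℕ i)) (<⇒≤ prev<l)

compAux-part : ∀ {prev} L n → AllPairs _<_ (prev ∷ L) → All (_< n) (prev ∷ L) →
  ∀ {a b} → a ∈ prev ∷ L → b ∈ L ⊎ b ≡ n → a < b → (∀ {c} → c ∈ L → a < c → c < b → ⊥) →
  Σ (Fin (length (compAux prev L n))) λ i →
    prev + prefixSum (compAux prev L n) (toℕ i) ≡ a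
    × prev + prefixSum (compAux prev L n) (suc (toℕ i)) ≡ b
compAux-part {prev} [] n _ _ (here refl) (inj₂ refl) prev<n _ =
  zero , +-identityʳ prev , compAux-first [] (<⇒≤ prev<n)
compAux-part {prev} (l ∷ L) n ((prev<l ∷ _) ∷ (l<L ∷ _)) (_ ∷ l<n ∷ _) {b = b} (here refl) b∈ _ gap =
  zero , +-identityʳ prev , trans (compAux-first (compAux l L n) (<⇒≤ prev<l)) (next-cut b∈)
  where
  next-cut : b ∈ l ∷ L ⊎ b ≡ n → l ≡ b
  next-cut (inj₁ (here b≡l))    = sym b≡l
  next-cut (inj₁ (there b∈L))   = ⊥-elim (gap (here refl) prev<l (All.lookup l<L b∈L))
  next-cut (inj₂ refl)          = ⊥-elim (gap (here refl) prev<l l<n)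
compAux-part {prev} (l ∷ L) n ((prev<l ∷ _) ∷ sorted) (_ ∷ bounded) {a} {b} (there a∈) b∈ a<b gap
  with compAux-part L n sorted bounded a∈ (drop-first-cut b∈) a<b (λ c∈ → gap (there c∈))
  where
  drop-first-cut : b ∈ l ∷ L ⊎ b ≡ n → b ∈ L ⊎ b ≡ n
  drop-first-cut (inj₁ (here refl))  = ⊥-elim (<⇒≱ a<b (head-≤ sorted a∈))
  drop-first-cut (inj₁ (there b∈L)) = inj₁ b∈L
  drop-first-cut (inj₂ b≡n)         = inj₂ b≡n
... | i , start , end =
  suc i , trans (compAux-suc L n (toℕ i) (<⇒≤ prev<l)) start
        , trans (compAux-suc L n (suc (toℕ i)) (<⇒≤ prev<l)) end

nonzeroLRM? : ∀ {n} (π : Permutation′ n) (j : Fin n) → Dec (IsLRM π j × ¬ toℕ j ≡ 0)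
nonzeroLRM? π j = isLRM? π j ×-dec ¬? (toℕ j ≟ 0)

module _ {n} (π : Permutation′ n) where

  ∈-LRM′⁺ : ∀ {j} → IsLRM π j → ¬ toℕ j ≡ 0 → toℕ j ∈ LRM′ π
  ∈-LRM′⁺ {j} lrm j≢0 = ∈-map⁺ toℕ (∈-filter⁺ (nonzeroLRM? π) (∈-allFin j) (lrm , j≢0))

  ∈-LRM′⁻ : ∀ {c} → c ∈ LRM′ π → ∃[ j ] c ≡ toℕ j × IsLRM π j × ¬ toℕ j ≡ 0
  ∈-LRM′⁻ c∈ with ∈-map⁻ toℕ c∈
  ... | j , j∈ , c≡j with ∈-filter⁻ (nonzeroLRM? π) {xs = allFin n} j∈
  ...   | _ , lrm , j≢0 = j , c≡j , lrm , j≢0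

  LRM′-sorted : AllPairs _<_ (0 ∷ LRM′ π)
  LRM′-sorted = All.tabulate positive
    ∷ AllPairs.map⁺ (AllPairs.filter⁺ (nonzeroLRM? π) (AllPairs.tabulate⁺-< (λ i<j → i<j)))
    where
    positive : ∀ {c} → c ∈ LRM′ π → 0 < c
    positive c∈ with ∈-LRM′⁻ c∈
    ... | _ , refl , _ , j≢0 = n≢0⇒n>0 j≢0

  LRM′-bounded : 0 < n → All (_< n) (0 ∷ LRM′ π)
  LRM′-bounded 0<n = 0<n ∷ All.tabulate below-n
    where
    below-n : ∀ {c} → c ∈ LRM′ π → c < n
    below-n c∈ with ∈-LRM′⁻ c∈
    ... | j , refl , _ = toℕ<n j

  cLRM′-part-bounds : 0 < n → (i : Fin (length (cLRM′ π))) →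
    prefixSum (cLRM′ π) (toℕ i) < prefixSum (cLRM′ π) (suc (toℕ i))
    × prefixSum (cLRM′ π) (suc (toℕ i)) ≤ n
  cLRM′-part-bounds 0<n = compAux-part-bounds (LRM′ π) n LRM′-sorted (LRM′-bounded 0<n)

  IsLRM-at : ∀ s → (∀ k → toℕ k < toℕ s → π ⟨$⟩ʳ s <ᶠ π ⟨$⟩ʳ k) → IsLRM π (π ⟨$⟩ʳ s)
  IsLRM-at s smaller-before k k<s = smaller-before k (subst (λ q → toℕ k < toℕ q) (inverseˡ π) k<s)

  record PrefixMin (t μ : ℕ) : Set where
    field
      lower-bound : ∀ k → toℕ k < t → μ ≤ toℕ (π ⟨$⟩ʳ k)
      attained    : μ ≡ n ⊎ ∃[ s ] toℕ s < t × toℕ (π ⟨$⟩ʳ s) ≡ μ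

  open PrefixMin

  PrefixMin-≤ : ∀ {t μ} → PrefixMin t μ → μ ≤ n
  PrefixMin-≤ min with attained min
  ... | inj₁ refl          = ≤-refl
  ... | inj₂ (s , _ , refl) = <⇒≤ (toℕ<n _)

  PrefixMin-zero : PrefixMin 0 n
  PrefixMin-zero = record { lower-bound = λ _ (); attained = inj₁ refl }

  PrefixMin-keep : ∀ {s μ} → PrefixMin (toℕ s) μ → μ ≤ toℕ (π ⟨$⟩ʳ s) → PrefixMin (suc (toℕ s)) μ
  PrefixMin-keep {s} {μ} min μ≤πs = record { lower-bound = lower ; attained = earlier (attained min) }
    where
    lower : ∀ k → toℕ k < suc (toℕ s) → μ ≤ toℕ (π ⟨$⟩ʳ k)
    lower k k≤s with m<1+n⇒m<n∨m≡n k≤s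
    ... | inj₁ k<s = lower-bound min k k<s
    ... | inj₂ k≡s = subst (λ q → _ ≤ toℕ (π ⟨$⟩ʳ q)) (sym (toℕ-injective k≡s)) μ≤πs
    earlier : μ ≡ n ⊎ ∃[ r ] toℕ r < toℕ s × toℕ (π ⟨$⟩ʳ r) ≡ μ →
              μ ≡ n ⊎ ∃[ r ] toℕ r < suc (toℕ s) × toℕ (π ⟨$⟩ʳ r) ≡ μ
    earlier (inj₁ μ≡n)            = inj₁ μ≡n
    earlier (inj₂ (r , r<s , πr≡μ)) = inj₂ (r , m<n⇒m<1+n r<s , πr≡μ)

  PrefixMin-new : ∀ {s μ} → PrefixMin (toℕ s) μ → toℕ (π ⟨$⟩ʳ s) < μ →
    PrefixMin (suc (toℕ s)) (toℕ (π ⟨$⟩ʳ s))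
  PrefixMin-new {s} min πs<μ = record { lower-bound = lower ; attained = inj₂ (s , ≤-refl , refl) }
    where
    lower : ∀ k → toℕ k < suc (toℕ s) → toℕ (π ⟨$⟩ʳ s) ≤ toℕ (π ⟨$⟩ʳ k)
    lower k k≤s with m<1+n⇒m<n∨m≡n k≤s
    ... | inj₁ k<s = <⇒≤ (<-≤-trans πs<μ (lower-bound min k k<s))
    ... | inj₂ k≡s = ≤-reflexive (cong (λ q → toℕ (π ⟨$⟩ʳ q)) (sym (toℕ-injective k≡s)))

  LRM-gap : ∀ {s μ j} → PrefixMin (toℕ s) μ → IsLRM π j →
    toℕ (π ⟨$⟩ʳ s) < toℕ j → toℕ j < μ → ⊥
  LRM-gap {s} {μ} {j} min lrm πs<j j<μ with <-cmp (toℕ (π ⟨$⟩ˡ j)) (toℕ s)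
  ... | tri< before _ _ = <⇒≱ j<μ (subst (λ q → μ ≤ toℕ q) (inverseʳ π) (lower-bound min _ before))
  ... | tri≈ _ same _   = <-irrefl (cong toℕ (trans (cong (π ⟨$⟩ʳ_) (sym (toℕ-injective same))) (inverseʳ π))) πs<j
  ... | tri> _ _ after  = <-asym πs<j (lrm s after)

  cLRM′-part : ∀ {s μ} → PrefixMin (toℕ s) μ → toℕ (π ⟨$⟩ʳ s) < μ → Part (cLRM′ π) (toℕ (π ⟨$⟩ʳ s)) μ
  cLRM′-part {s} {μ} min πs<μ
    with compAux-part (LRM′ π) n LRM′-sorted (LRM′-bounded (≤-<-trans z≤n (toℕ<n s))) start-cut (end-cut (attained min)) πs<μ gap
    where
    start-cut : toℕ (π ⟨$⟩ʳ s) ∈ 0 ∷ LRM′ π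
    start-cut with toℕ (π ⟨$⟩ʳ s) ≟ 0
    ... | yes πs≡0 = here πs≡0
    ... | no  πs≢0 = there (∈-LRM′⁺ (IsLRM-at s (λ k k<s → <-≤-trans πs<μ (lower-bound min k k<s))) πs≢0)
    end-cut : μ ≡ n ⊎ ∃[ r ] toℕ r < toℕ s × toℕ (π ⟨$⟩ʳ r) ≡ μ → μ ∈ LRM′ π ⊎ μ ≡ n
    end-cut (inj₁ μ≡n)              = inj₂ μ≡n
    end-cut (inj₂ (r , r<s , refl)) = inj₁ (∈-LRM′⁺ (IsLRM-at r smaller-before) (λ πr≡0 → <⇒≱ πs<μ (subst (_≤ _) (sym πr≡0) z≤n)))
      where
      smaller-before : ∀ k → toℕ k < toℕ r → π ⟨$⟩ʳ r <ᶠ π ⟨$⟩ʳ k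
      smaller-before k k<r = ≤∧≢⇒< (lower-bound min k (<-trans k<r r<s))
        (λ πr≡πk → <-irrefl (cong toℕ (sym (Injection.injective (↔⇒↣ π) (toℕ-injective πr≡πk)))) k<r)
    gap : ∀ {c} → c ∈ LRM′ π → toℕ (π ⟨$⟩ʳ s) < c → c < μ → ⊥
    gap c∈ with ∈-LRM′⁻ c∈
    ... | j , refl , lrm , _ = LRM-gap min lrm
  ... | i , start , end = part i start end

ascending-spread : ∀ {n} (f : Fin n → Fin n) {a b} →
  (∀ x y → toℕ y ≡ suc (toℕ x) → a ≤ toℕ x → toℕ y < b → f x <ᶠ f y) →
  ∀ d (x z : Fin n) → toℕ z ≡ d + toℕ x → a ≤ toℕ x → toℕ z < b → d + toℕ (f x) ≤ toℕ (f z)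
ascending-spread f ascending zero x z z≡x _ _ =
  ≤-reflexive (cong (λ q → toℕ (f q)) (toℕ-injective (sym z≡x)))
ascending-spread {n} f {b = b} ascending (suc d) x z z≡ a≤x z<b =
  ≤-trans (s≤s (ascending-spread f ascending d x y y≡ a≤x y<b))
          (ascending y z (trans z≡ (cong suc (sym y≡))) (≤-trans a≤x (subst (_ ≤_) (sym y≡) (m≤n+m (toℕ x) d))) z<b)
  where
  y<n : d + toℕ x < n
  y<n = <-trans (n<1+n _) (subst (_< n) z≡ (toℕ<n z))
  y : Fin n
  y = fromℕ< y<n
  y≡ : toℕ y ≡ d + toℕ x
  y≡ = toℕ-fromℕ< y<n
  y<b : toℕ y < b
  y<b = subst (_< b) (sym y≡) (<-trans (n<1+n _) (subst (_< b) z≡ z<b))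

VShape-fixing-start : ∀ {n} (v : Permutation′ n) {a b} → VShape v a b → b ≤ n →
  (x₀ : Fin n) → toℕ x₀ ≡ a → v ⟨$⟩ʳ x₀ ≡ x₀ →
  (∀ x → a ≤ toℕ x → toℕ x < b → a ≤ toℕ (v ⟨$⟩ʳ x) × toℕ (v ⟨$⟩ʳ x) < b) →
  ∀ x → a ≤ toℕ x → toℕ x < b → v ⟨$⟩ʳ x ≡ x
VShape-fixing-start {n} v {a} {b} (m , a≤m , m<b , descending , ascending) b≤n x₀ refl vx₀≡x₀ into x a≤x x<b =
  toℕ-injective (≤-antisym vx≤x x≤vx)
  where
  -- x₀ is the lowest point of [a, b) and is fixed, so v cannot descend right after it.
  no-descent : ¬ toℕ x₀ < toℕ m
  no-descent x₀<m = <⇒≱ (subst (λ q → toℕ (v ⟨$⟩ʳ x₁) < toℕ q) vx₀≡x₀ v-descends) (proj₁ (into x₁ x₀≤x₁ x₁<b))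
    where
    x₁<n : suc (toℕ x₀) < n
    x₁<n = ≤-<-trans x₀<m (<-≤-trans m<b b≤n)
    x₁ : Fin n
    x₁ = fromℕ< x₁<n
    x₀≤x₁ : toℕ x₀ ≤ toℕ x₁
    x₀≤x₁ = subst (toℕ x₀ ≤_) (sym (toℕ-fromℕ< x₁<n)) (n≤1+n _)
    x₁<b : toℕ x₁ < b
    x₁<b = subst (_< b) (sym (toℕ-fromℕ< x₁<n)) (≤-<-trans x₀<m m<b)
    v-descends : v ⟨$⟩ʳ x₁ <ᶠ v ⟨$⟩ʳ x₀
    v-descends = descending x₀ x₁ (toℕ-fromℕ< x₁<n) ≤-refl (subst (_≤ toℕ m) (sym (toℕ-fromℕ< x₁<n)) x₀<m)
  spread : ∀ d (y z : Fin n) → toℕ z ≡ d + toℕ y → toℕ x₀ ≤ toℕ y → toℕ z < b →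
    d + toℕ (v ⟨$⟩ʳ y) ≤ toℕ (v ⟨$⟩ʳ z)
  spread = ascending-spread (v ⟨$⟩ʳ_) (λ y z z≡ a≤y → ascending y z z≡ (≤-trans (≮⇒≥ no-descent) a≤y))
  x≤vx : toℕ x ≤ toℕ (v ⟨$⟩ʳ x)
  x≤vx = subst (_≤ toℕ (v ⟨$⟩ʳ x)) (trans (cong (λ q → (toℕ x ∸ toℕ x₀) + toℕ q) vx₀≡x₀) (m∸n+n≡m a≤x))
    (spread (toℕ x ∸ toℕ x₀) x₀ x (sym (m∸n+n≡m a≤x)) ≤-refl x<b)
  d : ℕ
  d = b ∸ suc (toℕ x)
  d+x+1≡b : d + suc (toℕ x) ≡ b
  d+x+1≡b = m∸n+n≡m x<b
  top<n : d + toℕ x < n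
  top<n = subst (_≤ n) (trans (sym d+x+1≡b) (+-suc d (toℕ x))) b≤n
  top : Fin n
  top = fromℕ< top<n
  vx≤x : toℕ (v ⟨$⟩ʳ x) ≤ toℕ x
  vx≤x = m<1+n⇒m≤n (+-cancelˡ-< d _ _ (subst (d + toℕ (v ⟨$⟩ʳ x) <_) (sym d+x+1≡b)
    (≤-<-trans (spread d x top (toℕ-fromℕ< top<n) a≤x top<b) (proj₂ (into top a≤top top<b)))))
    where
    top<b : toℕ top < b
    top<b = ≤-reflexive (trans (cong suc (toℕ-fromℕ< top<n)) (trans (sym (+-suc d (toℕ x))) d+x+1≡b))
    a≤top : toℕ x₀ ≤ toℕ top
    a≤top = subst (_ ≤_) (sym (toℕ-fromℕ< top<n)) (≤-trans a≤x (m≤n+m _ d))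

IsLRM-cong : ∀ {n} {u w : Permutation′ n} → u ≈ w → ∀ {j} → IsLRM u j → IsLRM w j
IsLRM-cong {u = u} {w} u≈w {j} lrm k k<pos =
  subst (λ q → j <ᶠ q) (u≈w k) (lrm k (subst (λ q → toℕ k < toℕ q) same-position k<pos))
  where
  same-position : w ⟨$⟩ˡ j ≡ u ⟨$⟩ˡ j
  same-position = trans (cong (w ⟨$⟩ˡ_) (trans (sym (inverseʳ u)) (u≈w _))) (inverseˡ w)

cLRM′-cong : ∀ {n} {u w : Permutation′ n} → u ≈ w → cLRM′ u ≡ cLRM′ w
cLRM′-cong {n} {u} {w} u≈w = cong (λ L → Comp n (map toℕ L))
  (filter-≐ (nonzeroLRM? u) (nonzeroLRM? w)
    ((λ (lrm , j≢0) → IsLRM-cong {u = u} {w} u≈w lrm , j≢0) , (λ (lrm , j≢0) → IsLRM-cong {u = w} {u} (λ k → sym (u≈w k)) lrm , j≢0))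
    (allFin n))

FixedFrom : ∀ {n} → Permutation′ n → ℕ → Set
FixedFrom v μ = ∀ z → μ ≤ toℕ z → v ⟨$⟩ʳ z ≡ z

FixedFrom-< : ∀ {n} {v : Permutation′ n} {μ} → FixedFrom v μ → ∀ {z} → toℕ z < μ → toℕ (v ⟨$⟩ʳ z) < μ
FixedFrom-< {v = v} {μ} fixed {z} z<μ =
  ≰⇒> λ μ≤vz → <⇒≱ z<μ (subst (λ q → μ ≤ toℕ q) (Injection.injective (↔⇒↣ v) (fixed _ μ≤vz)) μ≤vz)

PrefixMin-∘ : ∀ {n} {u v w : Permutation′ n} {t μ} → (∀ x → v ⟨$⟩ʳ (u ⟨$⟩ʳ x) ≡ w ⟨$⟩ʳ x) →
  FixedFrom v μ → PrefixMin u t μ → PrefixMin w t μ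
PrefixMin-∘ {n} {u} {v} {w} {t} {μ} v∘u≡w fixed min = record
  { lower-bound = λ k k<t → subst (λ q → μ ≤ toℕ q) (sym (w≡u k (lower-bound k k<t))) (lower-bound k k<t)
  ; attained    = attained-w attained
  }
  where
  open PrefixMin min
  w≡u : ∀ k → μ ≤ toℕ (u ⟨$⟩ʳ k) → w ⟨$⟩ʳ k ≡ u ⟨$⟩ʳ k
  w≡u k μ≤uk = trans (sym (v∘u≡w k)) (fixed _ μ≤uk)
  attained-w : μ ≡ n ⊎ ∃[ s ] toℕ s < t × toℕ (u ⟨$⟩ʳ s) ≡ μ → μ ≡ n ⊎ ∃[ s ] toℕ s < t × toℕ (w ⟨$⟩ʳ s) ≡ μ
  attained-w (inj₁ μ≡n)             = inj₁ μ≡n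
  attained-w (inj₂ (s , s<t , us≡μ)) = inj₂ (s , s<t , trans (cong toℕ (w≡u s (≤-reflexive (sym us≡μ)))) us≡μ)

module Rigidity {n} {w u : Permutation′ n} {p}
  (hβ : length (cLRM′ w) ≡ p) (hγ : length (cLRM′ u) ≡ p) (χ : Permutation′ p)
  (lengths-match : ∀ (i : Fin p) → lookup (cLRM′ w) (cast (sym hβ) (χ ⟨$⟩ʳ i)) ≡ lookup (cLRM′ u) (cast (sym hγ) i))
  (v : Permutation′ n)
  (parts-match : ∀ (i : Fin p) (x : Fin n) → InSet (cLRM′ u) (toℕ i) x → InSet (cLRM′ w) (toℕ (χ ⟨$⟩ʳ i)) (v ⟨$⟩ʳ x))
  (V-shaped : ∀ (i : Fin p) → VShapeOnSet v (cLRM′ u) (toℕ i))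
  (v∘u≡w : ∀ (x : Fin n) → v ⟨$⟩ʳ (u ⟨$⟩ʳ x) ≡ w ⟨$⟩ʳ x)
  where

  β γ : List ℕ
  β = cLRM′ w
  γ = cLRM′ u

  fixed-on-matched-parts : ∀ {μ} (ŷ : Fin n) → μ ≤ n → toℕ ŷ < μ → toℕ (v ⟨$⟩ʳ ŷ) < μ →
    Part γ (toℕ ŷ) μ → Part β (toℕ (v ⟨$⟩ʳ ŷ)) μ →
    ∀ z → toℕ ŷ ≤ toℕ z → toℕ z < μ → v ⟨$⟩ʳ z ≡ z
  fixed-on-matched-parts {μ} ŷ μ≤n ŷ<μ vŷ<μ Pγ Pβ = VShape-fixing-start v V-shape μ≤n ŷ refl vŷ≡ŷ maps-into
    where
    i : Fin p
    i = cast hγ (Part.index Pγ)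
    i≡ : toℕ i ≡ toℕ (Part.index Pγ)
    i≡ = toℕ-cast hγ _
    in-γ-part : ∀ {x} → toℕ ŷ ≤ toℕ x → toℕ x < μ → InSet γ (toℕ i) x
    in-γ-part {x} ŷ≤x x<μ = subst (λ k → InSet γ k x) (sym i≡) (InSet-Part⁺ Pγ ŷ≤x x<μ)
    χi≡j : toℕ (χ ⟨$⟩ʳ i) ≡ toℕ (Part.index Pβ)
    χi≡j = InSet-unique β (parts-match i ŷ (in-γ-part ≤-refl ŷ<μ)) (InSet-Part⁺ Pβ ≤-refl vŷ<μ)
    same-length : lookup β (Part.index Pβ) ≡ lookup γ (Part.index Pγ)
    same-length = begin
      lookup β (Part.index Pβ)              ≡⟨ cong (lookup β) (toℕ-injective (trans (sym χi≡j) (sym (toℕ-cast (sym hβ) _)))) ⟩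
      lookup β (cast (sym hβ) (χ ⟨$⟩ʳ i))    ≡⟨ lengths-match i ⟩
      lookup γ (cast (sym hγ) i)            ≡⟨ cong (lookup γ) (cast-involutive (sym hγ) hγ _) ⟩
      lookup γ (Part.index Pγ)              ∎
      where open ≡-Reasoning
    vŷ≡ŷ : v ⟨$⟩ʳ ŷ ≡ ŷ
    vŷ≡ŷ = toℕ-injective (+-cancelʳ-≡ _ _ _
      (trans (sym (Part-length Pβ)) (trans (Part-length Pγ) (cong (toℕ ŷ +_) (sym same-length)))))
    maps-into : ∀ x → toℕ ŷ ≤ toℕ x → toℕ x < μ → toℕ ŷ ≤ toℕ (v ⟨$⟩ʳ x) × toℕ (v ⟨$⟩ʳ x) < μ
    maps-into x ŷ≤x x<μ = subst (λ a → a ≤ toℕ (v ⟨$⟩ʳ x) × toℕ (v ⟨$⟩ʳ x) < μ) (cong toℕ vŷ≡ŷ)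
      (InSet-Part⁻ Pβ (subst (λ k → InSet β k (v ⟨$⟩ʳ x)) χi≡j (parts-match i x (in-γ-part ŷ≤x x<μ))))
    V-shape : VShape v (toℕ ŷ) μ
    V-shape = subst₂ (VShape v) (trans (cong (prefixSum γ) i≡) (Part.start Pγ))
      (trans (cong (λ k → prefixSum γ (suc k)) i≡) (Part.end Pγ)) (V-shaped i)

  fixed-below-new-minimum : ∀ {s μ} → PrefixMin u (toℕ s) μ → FixedFrom v μ → toℕ (u ⟨$⟩ʳ s) < μ →
    FixedFrom v (toℕ (u ⟨$⟩ʳ s))
  fixed-below-new-minimum {s} {μ} min fixed us<μ z us≤z with μ ≤? toℕ z
  ... | yes μ≤z = fixed z μ≤z
  ... | no  μ≰z = fixed-on-matched-parts (u ⟨$⟩ʳ s) (PrefixMin-≤ u min) us<μ vus<μ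
    (cLRM′-part u min us<μ) (subst (λ q → Part β (toℕ q) μ) (sym (v∘u≡w s)) (cLRM′-part w min-w ws<μ))
    z us≤z (≰⇒> μ≰z)
    where
    vus<μ : toℕ (v ⟨$⟩ʳ (u ⟨$⟩ʳ s)) < μ
    vus<μ = FixedFrom-< {v = v} fixed us<μ
    ws<μ : toℕ (w ⟨$⟩ʳ s) < μ
    ws<μ = subst (λ q → toℕ q < μ) (v∘u≡w s) vus<μ
    min-w : PrefixMin w (toℕ s) μ
    min-w = PrefixMin-∘ {u = u} {v} {w} v∘u≡w fixed min

  scan-step : ∀ {μ} (s : Fin n) → PrefixMin u (toℕ s) μ → FixedFrom v μ →
    ∃[ μ′ ] PrefixMin u (suc (toℕ s)) μ′ × FixedFrom v μ′
  scan-step {μ} s min fixed with μ ≤? toℕ (u ⟨$⟩ʳ s)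
  ... | yes μ≤us = μ , PrefixMin-keep u min μ≤us , fixed
  ... | no  μ≰us = _ , PrefixMin-new u min (≰⇒> μ≰us) , fixed-below-new-minimum min fixed (≰⇒> μ≰us)

  fixed-from-prefixMin : ∀ t → t ≤ n → ∃[ μ ] PrefixMin u t μ × FixedFrom v μ
  fixed-from-prefixMin zero    _   = n , PrefixMin-zero u , λ z n≤z → ⊥-elim (<⇒≱ (toℕ<n z) n≤z)
  fixed-from-prefixMin (suc t) t<n with fixed-from-prefixMin t (<⇒≤ t<n) | fromℕ< t<n | toℕ-fromℕ< t<n
  ... | μ , min , fixed | s | refl = scan-step s min fixed

  v≈id : v ≈ id
  v≈id z with fixed-from-prefixMin n ≤-refl
  ... | μ , min , fixed =
    fixed z (subst (λ q → μ ≤ toℕ q) (inverseʳ u) (PrefixMin.lower-bound min (u ⟨$⟩ˡ z) (toℕ<n _)))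

  γ≡β : γ ≡ β
  γ≡β = cLRM′-cong {u = u} {w} (λ x → trans (sym (v≈id (u ⟨$⟩ʳ x))) (v∘u≡w x))

  χ≈id : 0 < n → χ ≈ id
  χ≈id 0<n i = toℕ-injective (InSet-unique γ in-χi in-i)
    where
    k : Fin (length γ)
    k = cast (sym hγ) i
    k≡i : toℕ k ≡ toℕ i
    k≡i = toℕ-cast (sym hγ) i
    bounds : prefixSum γ (toℕ k) < prefixSum γ (suc (toℕ k)) × prefixSum γ (suc (toℕ k)) ≤ n
    bounds = cLRM′-part-bounds u 0<n k
    x<n : prefixSum γ (toℕ k) < n
    x<n = <-≤-trans (proj₁ bounds) (proj₂ bounds)
    x : Fin n
    x = fromℕ< x<n
    in-i : InSet γ (toℕ i) x
    in-i = subst (λ j → InSet γ j x) k≡i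
      (≤-reflexive (sym (toℕ-fromℕ< x<n)) , subst (_< prefixSum γ (suc (toℕ k))) (sym (toℕ-fromℕ< x<n)) (proj₁ bounds))
    in-χi : InSet γ (toℕ (χ ⟨$⟩ʳ i)) x
    in-χi = subst₂ (λ α y → InSet α (toℕ (χ ⟨$⟩ʳ i)) y) (sym γ≡β) (v≈id x) (parts-match i x in-i)

lemma5p2 : (n : ℕ) → 1 ≤ n → (w u : Permutation′ n) →
    cLRM′ w ↭ cLRM′ u →
    (p : ℕ) → (hβ : length (cLRM′ w) ≡ p) → (hγ : length (cLRM′ u) ≡ p) →
    (χ : Permutation′ p) →
    (∀ (i : Fin p) → lookup (cLRM′ w) (cast (sym hβ) (χ ⟨$⟩ʳ i)) ≡ lookup (cLRM′ u) (cast (sym hγ) i)) →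
    (v : Permutation′ n) →
    (∀ (i : Fin p) (x : Fin n) → InSet (cLRM′ u) (toℕ i) x → InSet (cLRM′ w) (toℕ (χ ⟨$⟩ʳ i)) (v ⟨$⟩ʳ x)) →
    (∀ (i : Fin p) → VShapeOnSet v (cLRM′ u) (toℕ i)) →
    (∀ (x : Fin n) → v ⟨$⟩ʳ (u ⟨$⟩ʳ x) ≡ w ⟨$⟩ʳ x) →
    (χ ≈ id) × (v ≈ id) × (cLRM′ u ≡ cLRM′ w)
lemma5p2 n 1≤n w u _ p hβ hγ χ lengths-match v parts-match V-shaped v∘u≡w = χ≈id 1≤n , v≈id , γ≡β
  where open Rigidity {n} {w} {u} {p} hβ hγ χ lengths-match v parts-match V-shaped v∘u≡w
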